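{- Let $n\ge0$ and $j\ge0$ be integers. The number of partitions $\pi$ with $\mathcal{E}(\pi)=n$ and $\gamma(\pi)=j$ equals the number of 2-color partitions of $n$ (parts colored red or green) in which every red part is $\le j$.
   Context: A partition $\pi=(\lambda_1,\lambda_2,\dots)$ is a finite non-increasing sequence of positive integers; the empty sequence is the unique partition of $0$. $\mathcal{E}(\pi)=\lambda_2+\lambda_4+\cdots$ and $\gamma(\pi)=\lambda_1-\lambda_2+\lambda_3-\lambda_4+\cdots$. In a 2-color partition each part is colored red or green; partitions differing in coloring are distinct; green parts are unrestricted. -}

module Defs where

open import Data.Nat using (ℕ; zero; suc; _+_; _∸_; _≤_; _≥_; _<_)
open import Data.List using (List; []; _∷_)
open import Data.Nat.ListAction using (sum)
open import Data.List.Relation.Unary.All using (All)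
open import Data.List.Relation.Unary.Linked using (Linked)
open import Data.Product using (Σ; _×_)
open import Relation.Binary.PropositionalEquality using (_≡_)

IsPartition : List ℕ → Set
IsPartition l = Linked _≥_ l × All (0 <_) l

Partition : Set
Partition = Σ (List ℕ) IsPartition

𝓔 : List ℕ → ℕ
𝓔 [] = 0
𝓔 (a ∷ []) = 0
𝓔 (a ∷ b ∷ rest) = b + 𝓔 rest

-- γ(π) = λ₁ - λ₂ + λ₃ - λ₄ + ⋯  (each λ_{2i-1} - λ_{2i} ≥ 0 for partitions)
γ : List ℕ → ℕ
γ [] = 0
γ (a ∷ []) = a
γ (a ∷ b ∷ rest) = (a ∸ b) + γ rest

PartsEγ : ℕ → ℕ → Set
PartsEγ n j = Σ (List ℕ) λ l → IsPartition l × 𝓔 l ≡ n × γ l ≡ j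

TwoColorRedBounded : ℕ → ℕ → Set
TwoColorRedBounded n j =
  Σ (List ℕ) λ red → Σ (List ℕ) λ green →
    IsPartition red × IsPartition green × sum red + sum green ≡ n × All (_≤ j) red

-- Cut a partition into pairs (λ₁, λ₂), (λ₃, λ₄), … .  For the pair (λ_{2i-1}, λ_{2i}) put
-- rᵢ = γ(λ_{2i+1}, λ_{2i+2}, …) and gᵢ = λ_{2i} − rᵢ, dropping zeros.  Since γ telescopes,
-- r₁ ≥ r₂ ≥ ⋯ are all ≤ γ(π), the gᵢ are non-increasing, and Σ rᵢ + Σ gᵢ = Σ λ_{2i} = 𝓔(π).
-- Conversely λ_{2i} = rᵢ + gᵢ and λ_{2i-1} = r_{i-1} + gᵢ with r₀ = γ(π), so the red parts rᵢ
-- and green parts gᵢ determine π.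
module Submission where

open import Defs
open import Data.List using (List; []; _∷_)
open import Data.List.Relation.Unary.All as All using (All; []; _∷_)
open import Data.List.Relation.Unary.Linked as Linked using (Linked; []; [-]; _∷_)
open import Data.List.Relation.Unary.Linked.Properties using (Linked⇒All)
open import Data.Nat using (ℕ; zero; suc; _+_; _∸_; _≤_; _≥_; _<_; z≤n; s≤s)
open import Data.Nat.ListAction using (sum)
open import Data.Nat.Properties
open import Algebra.Properties.CommutativeSemigroup +-commutativeSemigroup using (interchange)
open import Data.Product using (_,_; proj₁; proj₂)
open import Function using (flip)
open import Function.Bundles using (_↔_; mk↔ₛ′)
open import Relation.Binary.PropositionalEquality

infixr 5 _∷₊_

_∷₊_ : ℕ → List ℕ → List ℕ
zero  ∷₊ xs = xs
suc x ∷₊ xs = suc x ∷ xs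

∷₊-positive : ∀ x {xs} → All (0 <_) xs → All (0 <_) (x ∷₊ xs)
∷₊-positive zero    ps = ps
∷₊-positive (suc x) ps = s≤s z≤n ∷ ps

∷₊-of-positive : ∀ {x} xs → 0 < x → x ∷₊ xs ≡ x ∷ xs
∷₊-of-positive {suc x} xs _ = refl

sum-∷₊ : ∀ x xs → sum (x ∷₊ xs) ≡ x + sum xs
sum-∷₊ zero    xs = refl
sum-∷₊ (suc x) xs = refl

Linked-∷₊ : ∀ {x y ys} → y ≤ x → Linked _≥_ (y ∷ ys) → Linked _≥_ (x ∷ y ∷₊ ys)
Linked-∷₊ {y = zero}  {[]}    _   _           = [-]
Linked-∷₊ {y = zero}  {_ ∷ _} y≤x (z≤y ∷ ys↓) = ≤-trans z≤y y≤x ∷ ys↓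
Linked-∷₊ {y = suc _}         y≤x ys↓         = y≤x ∷ ys↓

Linked⇒bounded : ∀ {x xs} → Linked _≥_ (x ∷ xs) → All (_≤ x) xs
Linked⇒bounded xs↓ = All.tail (Linked⇒All (flip ≤-trans) ≤-refl xs↓)

bounded⇒Linked : ∀ {x xs} → All (_≤ x) xs → Linked _≥_ xs → Linked _≥_ (x ∷ xs)
bounded⇒Linked []        _   = [-]
bounded⇒Linked (y≤x ∷ _) xs↓ = y≤x ∷ xs↓

bounded-by-0 : ∀ {x xs} → Linked _≥_ (x ∷ xs) → All (0 <_) xs → x ≡ 0 → xs ≡ []
bounded-by-0 [-]       []        _    = refl
bounded-by-0 (y≤x ∷ _) (0<y ∷ _) refl with () ← ≤-trans 0<y y≤x

head₀ : List ℕ → ℕ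
head₀ []      = 0
head₀ (x ∷ _) = x

head₀-≤ : ∀ {x xs} → Linked _≥_ (x ∷ xs) → head₀ xs ≤ x
head₀-≤ [-]       = z≤n
head₀-≤ (y≤x ∷ _) = y≤x

γ≤head : ∀ {b} r → Linked _≥_ (b ∷ r) → γ r ≤ b
γ≤head []          _                 = z≤n
γ≤head (a ∷ [])    (a≤b ∷ _)         = a≤b
γ≤head (a ∷ c ∷ r) (a≤b ∷ c≤a ∷ r↓) = begin
  (a ∸ c) + γ r ≤⟨ +-monoʳ-≤ (a ∸ c) (γ≤head r r↓) ⟩
  (a ∸ c) + c   ≡⟨ m∸n+n≡m c≤a ⟩
  a             ≤⟨ a≤b ⟩
  _             ∎
  where open ≤-Reasoning

redParts : List ℕ → List ℕ
redParts []          = []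
redParts (a ∷ [])    = []
redParts (a ∷ b ∷ r) = γ r ∷₊ redParts r

greenParts : List ℕ → List ℕ
greenParts []          = []
greenParts (a ∷ [])    = []
greenParts (a ∷ b ∷ r) = (b ∸ γ r) ∷₊ greenParts r

redParts-below-γ : ∀ l → Linked _≥_ (γ l ∷ redParts l)
redParts-below-γ []          = [-]
redParts-below-γ (a ∷ [])    = [-]
redParts-below-γ (a ∷ b ∷ r) = Linked-∷₊ (m≤n+m (γ r) (a ∸ b)) (redParts-below-γ r)

greenParts-below : ∀ {b} r → Linked _≥_ (b ∷ r) → Linked _≥_ ((b ∸ γ r) ∷ greenParts r)
greenParts-below     []          _                 = [-]
greenParts-below     (a ∷ [])    _                 = [-]
greenParts-below {b} (a ∷ c ∷ r) (a≤b ∷ c≤a ∷ r↓) = Linked-∷₊ bound (greenParts-below r r↓)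
  where
  open ≤-Reasoning
  bound : c ∸ γ r ≤ b ∸ ((a ∸ c) + γ r)
  bound = begin
    c ∸ γ r               ≡⟨ cong (_∸ γ r) (m∸[m∸n]≡n c≤a) ⟨
    a ∸ (a ∸ c) ∸ γ r     ≡⟨ ∸-+-assoc a (a ∸ c) (γ r) ⟩
    a ∸ ((a ∸ c) + γ r)   ≤⟨ ∸-monoˡ-≤ ((a ∸ c) + γ r) a≤b ⟩
    b ∸ ((a ∸ c) + γ r)   ∎

redParts-positive : ∀ l → All (0 <_) (redParts l)
redParts-positive []          = []
redParts-positive (a ∷ [])    = []
redParts-positive (a ∷ b ∷ r) = ∷₊-positive (γ r) (redParts-positive r)

greenParts-positive : ∀ l → All (0 <_) (greenParts l)
greenParts-positive []          = []
greenParts-positive (a ∷ [])    = []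
greenParts-positive (a ∷ b ∷ r) = ∷₊-positive (b ∸ γ r) (greenParts-positive r)

redParts-partition : ∀ l → IsPartition (redParts l)
redParts-partition l = Linked.tail (redParts-below-γ l) , redParts-positive l

greenParts-partition : ∀ {l} → Linked _≥_ l → IsPartition (greenParts l)
greenParts-partition {[]}        _        = [] , []
greenParts-partition {a ∷ []}    _        = [] , []
greenParts-partition {a ∷ b ∷ r} (_ ∷ r↓) =
  Linked.tail (Linked-∷₊ ≤-refl (greenParts-below r r↓)) , greenParts-positive (a ∷ b ∷ r)

sum-redParts+greenParts : ∀ {l} → Linked _≥_ l → sum (redParts l) + sum (greenParts l) ≡ 𝓔 l
sum-redParts+greenParts {[]}        _        = refl
sum-redParts+greenParts {a ∷ []}    _        = refl
sum-redParts+greenParts {a ∷ b ∷ r} (_ ∷ r↓) = begin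
  sum (γ r ∷₊ redParts r) + sum ((b ∸ γ r) ∷₊ greenParts r)
    ≡⟨ cong₂ _+_ (sum-∷₊ (γ r) (redParts r)) (sum-∷₊ (b ∸ γ r) (greenParts r)) ⟩
  (γ r + sum (redParts r)) + ((b ∸ γ r) + sum (greenParts r))
    ≡⟨ interchange (γ r) (sum (redParts r)) (b ∸ γ r) (sum (greenParts r)) ⟩
  (γ r + (b ∸ γ r)) + (sum (redParts r) + sum (greenParts r))
    ≡⟨ cong₂ _+_ (m+[n∸m]≡n (γ≤head r r↓)) (sum-redParts+greenParts (Linked.tail r↓)) ⟩
  b + 𝓔 r ∎
  where open ≡-Reasoning

assemble : ℕ → List ℕ → List ℕ → List ℕ
assemble j []       []       = j ∷₊ []
assemble j (r ∷ rs) []       = j ∷ r ∷ assemble r rs []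
assemble j []       (g ∷ gs) = j + g ∷ g ∷ assemble 0 [] gs
assemble j (r ∷ rs) (g ∷ gs) = j + g ∷ r + g ∷ assemble r rs gs

assemble-below : ∀ {x j rs gs} → Linked _≥_ (j ∷ rs) → Linked _≥_ gs → j + head₀ gs ≤ x →
                 Linked _≥_ (x ∷ assemble j rs gs)
assemble-below {j = j} {[]}    {[]}    _            _   j≤x =
  Linked-∷₊ (≤-trans (m≤m+n j 0) j≤x) [-]
assemble-below {j = j} {r ∷ _} {[]}    (r≤j ∷ rs↓)  _   j≤x =
  ≤-trans (m≤m+n j 0) j≤x ∷ r≤j ∷ assemble-below rs↓ [] (≤-reflexive (+-identityʳ r))
assemble-below {j = j} {[]}    {g ∷ _} _            gs↓ j+g≤x =
  j+g≤x ∷ m≤n+m g j ∷ assemble-below [-] (Linked.tail gs↓) (head₀-≤ gs↓)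
assemble-below {j = j} {r ∷ _} {g ∷ _} (r≤j ∷ rs↓)  gs↓ j+g≤x =
  j+g≤x ∷ +-monoˡ-≤ g r≤j ∷ assemble-below rs↓ (Linked.tail gs↓) (+-monoʳ-≤ r (head₀-≤ gs↓))

assemble-positive : ∀ {j rs gs} → Linked _≥_ (j ∷ rs) → All (0 <_) rs → All (0 <_) gs →
                    All (0 <_) (assemble j rs gs)
assemble-positive {j} {[]}    {[]}    _           _           _ = ∷₊-positive j []
assemble-positive {j} {r ∷ _} {[]}    (r≤j ∷ rs↓) (0<r ∷ rs₊) _ =
  ≤-trans 0<r r≤j ∷ 0<r ∷ assemble-positive rs↓ rs₊ []
assemble-positive {j} {[]}    {g ∷ _} _           _           (0<g ∷ gs₊) =
  ≤-trans 0<g (m≤n+m g j) ∷ 0<g ∷ assemble-positive [-] [] gs₊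
assemble-positive {j} {r ∷ _} {g ∷ _} (_ ∷ rs↓)   (_ ∷ rs₊)   (0<g ∷ gs₊) =
  ≤-trans 0<g (m≤n+m g j) ∷ ≤-trans 0<g (m≤n+m g r) ∷ assemble-positive rs↓ rs₊ gs₊

assemble-partition : ∀ {j rs gs} → Linked _≥_ (j ∷ rs) → All (0 <_) rs → IsPartition gs →
                     IsPartition (assemble j rs gs)
assemble-partition rs↓ rs₊ (gs↓ , gs₊) =
  Linked.tail (assemble-below rs↓ gs↓ ≤-refl) , assemble-positive rs↓ rs₊ gs₊

𝓔-assemble : ∀ j rs gs → 𝓔 (assemble j rs gs) ≡ sum rs + sum gs
𝓔-assemble zero    []       []       = refl
𝓔-assemble (suc j) []       []       = refl
𝓔-assemble j       (r ∷ rs) []       =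
  trans (cong (r +_) (𝓔-assemble r rs [])) (sym (+-assoc r (sum rs) 0))
𝓔-assemble j       []       (g ∷ gs) = cong (g +_) (𝓔-assemble 0 [] gs)
𝓔-assemble j       (r ∷ rs) (g ∷ gs) =
  trans (cong (r + g +_) (𝓔-assemble r rs gs)) (interchange r g (sum rs) (sum gs))

γ-assemble : ∀ {j} rs gs → Linked _≥_ (j ∷ rs) → γ (assemble j rs gs) ≡ j
γ-assemble {zero}  []       []       _           = refl
γ-assemble {suc j} []       []       _           = refl
γ-assemble {j}     (r ∷ rs) []       (r≤j ∷ rs↓) =
  trans (cong (j ∸ r +_) (γ-assemble rs [] rs↓)) (m∸n+n≡m r≤j)
γ-assemble {j}     []       (g ∷ gs) _           =
  trans (cong₂ _+_ (m+n∸n≡m j g) (γ-assemble [] gs [-])) (+-identityʳ j)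
γ-assemble {j}     (r ∷ rs) (g ∷ gs) (r≤j ∷ rs↓) = begin
  (j + g ∸ (r + g)) + γ (assemble r rs gs) ≡⟨ cong₂ _+_ j+g∸[r+g]≡j∸r (γ-assemble rs gs rs↓) ⟩
  (j ∸ r) + r                              ≡⟨ m∸n+n≡m r≤j ⟩
  j                                        ∎
  where
  open ≡-Reasoning
  j+g∸[r+g]≡j∸r : j + g ∸ (r + g) ≡ j ∸ r
  j+g∸[r+g]≡j∸r = trans (cong₂ _∸_ (+-comm j g) (+-comm r g)) ([m+n]∸[m+o]≡n∸o g j r)

redParts-assemble : ∀ {j} rs gs → Linked _≥_ (j ∷ rs) → All (0 <_) rs → redParts (assemble j rs gs) ≡ rs
redParts-assemble {zero}  []       []       _         _           = refl
redParts-assemble {suc j} []       []       _         _           = refl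
redParts-assemble         (r ∷ rs) []       (_ ∷ rs↓) (0<r ∷ rs₊) =
  trans (cong₂ _∷₊_ (γ-assemble rs [] rs↓) (redParts-assemble rs [] rs↓ rs₊)) (∷₊-of-positive rs 0<r)
redParts-assemble         []       (g ∷ gs) _         _           =
  cong₂ _∷₊_ (γ-assemble [] gs [-]) (redParts-assemble [] gs [-] [])
redParts-assemble         (r ∷ rs) (g ∷ gs) (_ ∷ rs↓) (0<r ∷ rs₊) =
  trans (cong₂ _∷₊_ (γ-assemble rs gs rs↓) (redParts-assemble rs gs rs↓ rs₊)) (∷₊-of-positive rs 0<r)

greenParts-assemble : ∀ {j} rs gs → Linked _≥_ (j ∷ rs) → All (0 <_) gs → greenParts (assemble j rs gs) ≡ gs
greenParts-assemble {zero}  []       []       _         _           = refl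
greenParts-assemble {suc j} []       []       _         _           = refl
greenParts-assemble         (r ∷ rs) []       (_ ∷ rs↓) _           =
  cong₂ _∷₊_ (trans (cong (r ∸_) (γ-assemble rs [] rs↓)) (n∸n≡0 r)) (greenParts-assemble rs [] rs↓ [])
greenParts-assemble         []       (g ∷ gs) _         (0<g ∷ gs₊) =
  trans (cong₂ _∷₊_ (cong (g ∸_) (γ-assemble [] gs [-])) (greenParts-assemble [] gs [-] gs₊))
        (∷₊-of-positive gs 0<g)
greenParts-assemble         (r ∷ rs) (g ∷ gs) (_ ∷ rs↓) (0<g ∷ gs₊) =
  trans (cong₂ _∷₊_ (trans (cong (r + g ∸_) (γ-assemble rs gs rs↓)) (m+n∸m≡n r g))
                    (greenParts-assemble rs gs rs↓ gs₊))
        (∷₊-of-positive gs 0<g)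

assemble-∷₊ : ∀ k {x y rs gs} → (x ≡ 0 → rs ≡ []) → (y ≡ 0 → gs ≡ []) → 0 < x + y →
              assemble k (x ∷₊ rs) (y ∷₊ gs) ≡ k + y ∷ x + y ∷ assemble x rs gs
assemble-∷₊ k {zero}  {zero}  _     _     ()
assemble-∷₊ k {zero}  {suc y} rs≡[] _     _ rewrite rs≡[] refl = refl
assemble-∷₊ k {suc x} {zero}  _     gs≡[] _
  rewrite gs≡[] refl | +-identityʳ k | +-identityʳ x = refl
assemble-∷₊ k {suc x} {suc y} _     _     _ = refl

assemble-split : ∀ {l} → IsPartition l → assemble (γ l) (redParts l) (greenParts l) ≡ l
assemble-split {[]}        _                          = refl
assemble-split {a ∷ []}    (_ , 0<a ∷ [])             = ∷₊-of-positive [] 0<a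
assemble-split {a ∷ b ∷ r} (b≤a ∷ r↓ , _ ∷ 0<b ∷ r₊) = begin
  assemble ((a ∸ b) + γ r) (γ r ∷₊ redParts r) ((b ∸ γ r) ∷₊ greenParts r)
    ≡⟨ assemble-∷₊ (a ∸ b + γ r) (bounded-by-0 (redParts-below-γ r) (redParts-positive r))
                   (bounded-by-0 (greenParts-below r r↓) (greenParts-positive r))
                   (subst (0 <_) (sym γr+[b∸γr]≡b) 0<b) ⟩
  (a ∸ b) + γ r + (b ∸ γ r) ∷ γ r + (b ∸ γ r) ∷ assemble (γ r) (redParts r) (greenParts r)
    ≡⟨ cong₂ _∷_ a∸b+γr+[b∸γr]≡a (cong₂ _∷_ γr+[b∸γr]≡b (assemble-split (Linked.tail r↓ , r₊))) ⟩
  a ∷ b ∷ r ∎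
  where
  open ≡-Reasoning
  γr+[b∸γr]≡b : γ r + (b ∸ γ r) ≡ b
  γr+[b∸γr]≡b = m+[n∸m]≡n (γ≤head r r↓)
  a∸b+γr+[b∸γr]≡a : (a ∸ b) + γ r + (b ∸ γ r) ≡ a
  a∸b+γr+[b∸γr]≡a = trans (+-assoc (a ∸ b) (γ r) (b ∸ γ r))
                          (trans (cong (a ∸ b +_) γr+[b∸γr]≡b) (m∸n+n≡m b≤a))

IsPartition-irrelevant : ∀ {l} (p q : IsPartition l) → p ≡ q
IsPartition-irrelevant (p↓ , p₊) (q↓ , q₊) =
  cong₂ _,_ (Linked.irrelevant ≤-irrelevant p↓ q↓) (All.irrelevant ≤-irrelevant p₊ q₊)

PartsEγ-≡ : ∀ {n j} {x y : PartsEγ n j} → proj₁ x ≡ proj₁ y → x ≡ y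
PartsEγ-≡ {x = _ , p , e , g} {_ , p′ , e′ , g′} refl
  rewrite IsPartition-irrelevant p p′ | ≡-irrelevant e e′ | ≡-irrelevant g g′ = refl

TwoColorRedBounded-≡ : ∀ {n j} {x y : TwoColorRedBounded n j} →
                       proj₁ x ≡ proj₁ y → proj₁ (proj₂ x) ≡ proj₁ (proj₂ y) → x ≡ y
TwoColorRedBounded-≡ {x = _ , _ , p , q , e , b} {_ , _ , p′ , q′ , e′ , b′} refl refl
  rewrite IsPartition-irrelevant p p′ | IsPartition-irrelevant q q′ | ≡-irrelevant e e′
        | All.irrelevant ≤-irrelevant b b′ = refl

split : ∀ {n j} → PartsEγ n j → TwoColorRedBounded n j
split (l , (l↓ , _) , 𝓔l≡n , γl≡j) =
  redParts l , greenParts l , redParts-partition l , greenParts-partition l↓ ,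
  trans (sum-redParts+greenParts l↓) 𝓔l≡n ,
  subst (λ j → All (_≤ j) (redParts l)) γl≡j (Linked⇒bounded (redParts-below-γ l))

join : ∀ {n j} → TwoColorRedBounded n j → PartsEγ n j
join {j = j} (rs , gs , (rs↓ , rs₊) , gs-partition , sum≡n , rs≤j) =
  assemble j rs gs , assemble-partition (bounded⇒Linked rs≤j rs↓) rs₊ gs-partition ,
  trans (𝓔-assemble j rs gs) sum≡n , γ-assemble rs gs (bounded⇒Linked rs≤j rs↓)

split-join : ∀ {n j} (c : TwoColorRedBounded n j) → split (join c) ≡ c
split-join (rs , gs , (rs↓ , rs₊) , (_ , gs₊) , _ , rs≤j) =
  TwoColorRedBounded-≡ (redParts-assemble rs gs (bounded⇒Linked rs≤j rs↓) rs₊)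
                       (greenParts-assemble rs gs (bounded⇒Linked rs≤j rs↓) gs₊)

join-split : ∀ {n j} (π : PartsEγ n j) → join (split π) ≡ π
join-split (l , l-partition , refl , refl) = PartsEγ-≡ (assemble-split l-partition)

theorem5p5 : (n j : ℕ) → PartsEγ n j ↔ TwoColorRedBounded n j
theorem5p5 n j = mk↔ₛ′ split join split-join join-split
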